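{- Let $q$ be an odd prime power. Two proper conics in $PG(2,q)$ which intersect in exactly three points are not simultaneously diagonalizable.
   Context: $PG(2,q)$ is the projective plane over $GF(q)$. A conic is the zero set $\mathbb{V}(E)$ in $PG(2,q)$ of a nonzero quadratic form $E=ax^2+by^2+cz^2+dxy+exz+fyz$ over $GF(q)$; it is proper if its symmetric matrix (diagonal $2a,2b,2c$, off-diagonal $d,e,f$) is nonsingular. Two conics $\mathbb{V}(E_1),\mathbb{V}(E_2)$ are simultaneously diagonalizable if there is an invertible $3\times3$ matrix $S$ over $GF(q)$ such that both forms $v\mapsto E_1(Sv)$ and $v\mapsto E_2(Sv)$ have zero coefficients of $xy,xz,yz$. -}

module Defs where

open import Level using (0ℓ)
open import Algebra.Bundles using (CommutativeRing)
open import Data.Nat using (ℕ)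
open import Data.Fin using (Fin; zero; suc)
open import Data.Product using (Σ; ∃; _×_; _,_)
open import Data.Sum using (_⊎_)
open import Relation.Nullary using (¬_)
open import Relation.Binary using (Decidable)
open import Relation.Binary.PropositionalEquality using (_≡_)

record FiniteField (q : ℕ) : Set₁ where
  field
    cring : CommutativeRing 0ℓ 0ℓ
  open CommutativeRing cring public
  field
    _≟_       : Decidable _≈_
    0≉1       : ¬ (0# ≈ 1#)
    inverse   : ∀ x → ¬ (x ≈ 0#) → ∃ λ y → x * y ≈ 1#
    enum      : Fin q → Carrier
    enum-surj : ∀ x → ∃ λ i → enum i ≈ x
    enum-inj  : ∀ i j → enum i ≈ enum j → i ≡ j

module _ {q : ℕ} (F : FiniteField q) where
  open FiniteField F using (Carrier; _≈_; _+_; _*_; _-_; 0#; 1#)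

  Vec3 : Set
  Vec3 = Fin 3 → Carrier

  Mat3 : Set
  Mat3 = Fin 3 → Fin 3 → Carrier

  i0 i1 i2 : Fin 3
  i0 = zero
  i1 = suc zero
  i2 = suc (suc zero)

  sum3 : (Fin 3 → Carrier) → Carrier
  sum3 g = g i0 + g i1 + g i2

  _·v_ : Mat3 → Vec3 → Vec3
  (S ·v v) i = sum3 (λ k → S i k * v k)

  _·m_ : Mat3 → Mat3 → Mat3
  (S ·m T) i j = sum3 (λ k → S i k * T k j)

  idM : Mat3
  idM i j with i Data.Fin.≟ j
  ... | Relation.Nullary.yes _ = 1#
  ... | Relation.Nullary.no _  = 0#

  _≈M_ : Mat3 → Mat3 → Set
  S ≈M T = ∀ i j → S i j ≈ T i j

  Invertible : Mat3 → Set
  Invertible S = ∃ λ T → ((S ·m T) ≈M idM) × ((T ·m S) ≈M idM)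

  det3 : Mat3 → Carrier
  det3 M = M i0 i0 * (M i1 i1 * M i2 i2 - M i1 i2 * M i2 i1)
         - M i0 i1 * (M i1 i0 * M i2 i2 - M i1 i2 * M i2 i0)
         + M i0 i2 * (M i1 i0 * M i2 i1 - M i1 i1 * M i2 i0)

  -- quadratic form  a x² + b y² + c z² + d xy + e xz + f yz
  record QForm : Set where
    constructor qform
    field
      a b c d e f : Carrier

  NonzeroForm : QForm → Set
  NonzeroForm (qform a b c d e f) =
    ¬ (a ≈ 0#) ⊎ ¬ (b ≈ 0#) ⊎ ¬ (c ≈ 0#) ⊎ ¬ (d ≈ 0#) ⊎ ¬ (e ≈ 0#) ⊎ ¬ (f ≈ 0#)

  eval : QForm → Vec3 → Carrier
  eval (qform a b c d e f) v =
    a * (x * x) + b * (y * y) + c * (z * z) + d * (x * y) + e * (x * z) + f * (y * z)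
    where
      x = v i0
      y = v i1
      z = v i2

  two : Carrier
  two = 1# + 1#

  symMat : QForm → Mat3
  symMat (qform a b c d e f) zero zero = two * a
  symMat (qform a b c d e f) zero (suc zero) = d
  symMat (qform a b c d e f) zero (suc (suc zero)) = e
  symMat (qform a b c d e f) (suc zero) zero = d
  symMat (qform a b c d e f) (suc zero) (suc zero) = two * b
  symMat (qform a b c d e f) (suc zero) (suc (suc zero)) = f
  symMat (qform a b c d e f) (suc (suc zero)) zero = e
  symMat (qform a b c d e f) (suc (suc zero)) (suc zero) = f
  symMat (qform a b c d e f) (suc (suc zero)) (suc (suc zero)) = two * c

  Proper : QForm → Set
  Proper E = NonzeroForm E × ¬ (det3 (symMat E) ≈ 0#)

  unit : Fin 3 → Vec3
  unit i j with i Data.Fin.≟ j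
  ... | Relation.Nullary.yes _ = 1#
  ... | Relation.Nullary.no _  = 0#

  _+v_ : Vec3 → Vec3 → Vec3
  (u +v v) i = u i + v i

  -- coefficient of the monomial x_i x_j (i ≠ j) of a quadratic form given
  -- as a function Q : GF(q)^3 → GF(q):  Q(e_i + e_j) - Q(e_i) - Q(e_j)
  crossCoeff : (Vec3 → Carrier) → Fin 3 → Fin 3 → Carrier
  crossCoeff Q i j = Q (unit i +v unit j) - Q (unit i) - Q (unit j)

  DiagonalUnder : Mat3 → QForm → Set
  DiagonalUnder S E =
    (crossCoeff Q i0 i1 ≈ 0#) × (crossCoeff Q i0 i2 ≈ 0#) × (crossCoeff Q i1 i2 ≈ 0#)
    where
      Q : Vec3 → Carrier
      Q v = eval E (S ·v v)

  SimultaneouslyDiagonalizable : QForm → QForm → Set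
  SimultaneouslyDiagonalizable E₁ E₂ =
    ∃ λ S → Invertible S × DiagonalUnder S E₁ × DiagonalUnder S E₂

  -- projective points of PG(2,q): nonzero vectors up to nonzero scalars
  NonzeroVec : Vec3 → Set
  NonzeroVec v = ¬ (∀ i → v i ≈ 0#)

  SamePoint : Vec3 → Vec3 → Set
  SamePoint u v = ∃ λ t → ∀ i → u i ≈ t * v i

  OnBoth : QForm → QForm → Vec3 → Set
  OnBoth E₁ E₂ v = NonzeroVec v × (eval E₁ v ≈ 0#) × (eval E₂ v ≈ 0#)

  MeetInExactlyThreePoints : QForm → QForm → Set
  MeetInExactlyThreePoints E₁ E₂ =
    Σ Vec3 λ p₁ → Σ Vec3 λ p₂ → Σ Vec3 λ p₃ →
      OnBoth E₁ E₂ p₁ × OnBoth E₁ E₂ p₂ × OnBoth E₁ E₂ p₃ ×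
      ¬ SamePoint p₁ p₂ × ¬ SamePoint p₁ p₃ × ¬ SamePoint p₂ p₃ ×
      (∀ v → OnBoth E₁ E₂ v → SamePoint v p₁ ⊎ SamePoint v p₂ ⊎ SamePoint v p₃)

module Submission where

-- If S diagonalizes both forms, then v ↦ S v maps the common points of the two diagonal
-- conics κ₁ · x² = 0 and κ₂ · x² = 0, where κᵢₗ = Eᵢ (S eₗ), bijectively onto those of E₁ and E₂.
-- Properness of E₁ forces 2 ≠ 0 and every κ₁ₗ ≠ 0 (otherwise S eₗ would span the kernel of the
-- Gram matrix). The common points of diagonal conics are closed under the sign changes xₗ ↦ -xₗ, and
-- each has at most one zero coordinate. A common point without zeros has four distinct sign changes.
-- If A vanishes at k, the line xₖ = 0 carries only A and its sign change; a third common point off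
-- that line again has a sign change distinct from all three. So there are never exactly three.

open import Defs
open import Data.Nat using (ℕ; _^_; _%_)
open import Data.Nat.Primality using (Prime)
open import Data.Product using (∃; _×_)
open import Relation.Nullary using (¬_)
open import Relation.Binary.PropositionalEquality using (_≡_; _≢_)

open import Level using (0ℓ)
open import Algebra.Bundles using (CommutativeRing)
import Data.Nat as ℕ
import Data.Nat.Properties as ℕ
open import Data.Nat using (s≤s)
open import Data.Fin.Properties using (pigeonhole)
open import Data.Integer as ℤ using (ℤ; +_; -[1+_]; _⊖_)
open import Data.Integer.Properties using ([1+m]⊖[1+n]≡m⊖n)
open import Data.Sign as Sign using (Sign)
open import Data.Fin as Fin using (Fin; zero; suc)
open import Data.Product using (Σ; _,_; proj₁; proj₂)
open import Data.Sum as Sum using (_⊎_; inj₁; inj₂; [_,_]′)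
open import Data.Empty using (⊥; ⊥-elim)
open import Data.Maybe using (Maybe; just; nothing)
open import Relation.Nullary using (yes; no)
open import Relation.Nullary.Decidable using (toSum)
import Relation.Binary.PropositionalEquality as ≡
open import Algebra.Solver.Ring.AlmostCommutativeRing
  using (_-Raw-AlmostCommutative⟶_; fromCommutativeRing)

pattern i₀ = zero
pattern i₁ = suc zero
pattern i₂ = suc (suc zero)

-- The ring solver over an arbitrary commutative ring, with integer coefficients: its normal forms are
-- compared by computation, so the coefficients must be closed numerals rather than ring elements.
module IntegerCoefficientSolver (R : CommutativeRing 0ℓ 0ℓ) where
  open CommutativeRing R
  open import Relation.Binary.Reasoning.Setoid setoid
  open import Algebra.Properties.Semiring.Mult.TCOptimised semiring
    using (×-homo-+; ×-cong; ×1-homo-*) renaming (_×_ to _×′_)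
  open import Algebra.Properties.Group +-group using (⁻¹-involutive; ε⁻¹≈ε)
  open import Algebra.Properties.AbelianGroup +-abelianGroup using (⁻¹-∙-comm)
  open import Algebra.Properties.Ring ring using (-‿distribˡ-*; -‿distribʳ-*)

  -- With the optimised multiples _×′_, fromℤ (+ 1) is 1# and fromℤ (+ 2) is 1# + 1# definitionally,
  -- so the solver's constants 1 and 2 are literally 1# and two.
  fromℤ : ℤ → Carrier
  fromℤ (+ n)      = n ×′ 1#
  fromℤ (-[1+ n ]) = - (ℕ.suc n ×′ 1#)

  suc×1# : ∀ n → ℕ.suc n ×′ 1# ≈ 1# + n ×′ 1#
  suc×1# n = ×-homo-+ 1# 1 n

  ⊖-homo : ∀ m n → fromℤ (m ⊖ n) ≈ m ×′ 1# - n ×′ 1#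
  ⊖-homo ℕ.zero    ℕ.zero    = sym (-‿inverseʳ 0#)
  ⊖-homo ℕ.zero    (ℕ.suc n) = sym (+-identityˡ _)
  ⊖-homo (ℕ.suc m) ℕ.zero    = sym (trans (+-congˡ ε⁻¹≈ε) (+-identityʳ _))
  ⊖-homo (ℕ.suc m) (ℕ.suc n) rewrite [1+m]⊖[1+n]≡m⊖n m n = begin
    fromℤ (m ⊖ n)                    ≈⟨ ⊖-homo m n ⟩
    m ×′ 1# - n ×′ 1#                ≈⟨ +-congʳ (+-identityˡ _) ⟨
    0# + m ×′ 1# - n ×′ 1#           ≈⟨ +-congʳ (+-congʳ (-‿inverseʳ 1#)) ⟨
    1# - 1# + m ×′ 1# - n ×′ 1#      ≈⟨ +-congʳ (+-assoc 1# (- 1#) _) ⟩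
    1# + (- 1# + m ×′ 1#) - n ×′ 1#  ≈⟨ +-congʳ (+-congˡ (+-comm _ _)) ⟩
    1# + (m ×′ 1# - 1#) - n ×′ 1#    ≈⟨ +-congʳ (+-assoc 1# _ _) ⟨
    1# + m ×′ 1# - 1# - n ×′ 1#      ≈⟨ +-assoc _ _ _ ⟩
    1# + m ×′ 1# + (- 1# - n ×′ 1#)  ≈⟨ +-congˡ (⁻¹-∙-comm 1# _) ⟩
    1# + m ×′ 1# - (1# + n ×′ 1#)    ≈⟨ +-cong (suc×1# m) (-‿cong (suc×1# n)) ⟨
    ℕ.suc m ×′ 1# - ℕ.suc n ×′ 1#    ∎

  +-homo : ∀ i j → fromℤ (i ℤ.+ j) ≈ fromℤ i + fromℤ j
  +-homo (+ m)    (+ n)    = ×-homo-+ 1# m n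
  +-homo (+ m)    -[1+ n ] = ⊖-homo m (ℕ.suc n)
  +-homo -[1+ m ] (+ n)    = trans (⊖-homo n (ℕ.suc m)) (+-comm _ _)
  +-homo -[1+ m ] -[1+ n ] = begin
    - (ℕ.suc (ℕ.suc (m ℕ.+ n)) ×′ 1#)      ≈⟨ -‿cong (×-cong (≡.sym (ℕ.+-suc (ℕ.suc m) n)) refl) ⟩
    - ((ℕ.suc m ℕ.+ ℕ.suc n) ×′ 1#)        ≈⟨ -‿cong (×-homo-+ 1# (ℕ.suc m) (ℕ.suc n)) ⟩
    - (ℕ.suc m ×′ 1# + ℕ.suc n ×′ 1#)      ≈⟨ ⁻¹-∙-comm _ _ ⟨
    - (ℕ.suc m ×′ 1#) + - (ℕ.suc n ×′ 1#)  ∎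

  -‿homo : ∀ i → fromℤ (ℤ.- i) ≈ - fromℤ i
  -‿homo (+ ℕ.zero)  = sym ε⁻¹≈ε
  -‿homo (+ ℕ.suc n) = refl
  -‿homo -[1+ n ]    = sym (⁻¹-involutive _)

  signed : Sign → Carrier → Carrier
  signed Sign.+ x = x
  signed Sign.- x = - x

  signed-cong : ∀ s {x y} → x ≈ y → signed s x ≈ signed s y
  signed-cong Sign.+ x≈y = x≈y
  signed-cong Sign.- x≈y = -‿cong x≈y

  fromℤ-◃ : ∀ s n → fromℤ (s ℤ.◃ n) ≈ signed s (n ×′ 1#)
  fromℤ-◃ Sign.+ ℕ.zero    = refl
  fromℤ-◃ Sign.- ℕ.zero    = sym ε⁻¹≈ε
  fromℤ-◃ Sign.+ (ℕ.suc n) = refl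
  fromℤ-◃ Sign.- (ℕ.suc n) = refl

  fromℤ-signAbs : ∀ i → fromℤ i ≈ signed (ℤ.sign i) (ℤ.∣ i ∣ ×′ 1#)
  fromℤ-signAbs (+ n)    = refl
  fromℤ-signAbs -[1+ n ] = refl

  signed-* : ∀ s t x y → signed (s Sign.* t) (x * y) ≈ signed s x * signed t y
  signed-* Sign.+ Sign.+ x y = refl
  signed-* Sign.+ Sign.- x y = -‿distribʳ-* x y
  signed-* Sign.- Sign.+ x y = -‿distribˡ-* x y
  signed-* Sign.- Sign.- x y = begin
    x * y        ≈⟨ ⁻¹-involutive _ ⟨
    - - (x * y)  ≈⟨ -‿cong (-‿distribˡ-* x y) ⟩
    - (- x * y)  ≈⟨ -‿distribʳ-* _ _ ⟩
    - x * - y    ∎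

  *-homo : ∀ i j → fromℤ (i ℤ.* j) ≈ fromℤ i * fromℤ j
  *-homo i j = begin
    fromℤ (s ℤ.◃ ∣i∣ ℕ.* ∣j∣)                          ≈⟨ fromℤ-◃ s (∣i∣ ℕ.* ∣j∣) ⟩
    signed s ((∣i∣ ℕ.* ∣j∣) ×′ 1#)                     ≈⟨ signed-cong s (×1-homo-* ∣i∣ ∣j∣) ⟩
    signed s (∣i∣ ×′ 1# * ∣j∣ ×′ 1#)                   ≈⟨ signed-* (ℤ.sign i) (ℤ.sign j) _ _ ⟩
    signed (ℤ.sign i) (∣i∣ ×′ 1#) * signed (ℤ.sign j) (∣j∣ ×′ 1#)
                                                       ≈⟨ *-cong (fromℤ-signAbs i) (fromℤ-signAbs j) ⟨
    fromℤ i * fromℤ j                                  ∎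
    where
    s = ℤ.sign i Sign.* ℤ.sign j
    ∣i∣ = ℤ.∣ i ∣
    ∣j∣ = ℤ.∣ j ∣

  ℤ⟶R : ℤ.+-*-rawRing -Raw-AlmostCommutative⟶ fromCommutativeRing R
  ℤ⟶R = record
    { ⟦_⟧ = fromℤ ; +-homo = +-homo ; *-homo = *-homo ; -‿homo = -‿homo
    ; 0-homo = refl ; 1-homo = refl }

  fromℤ-equal? : ∀ i j → Maybe (fromℤ i ≈ fromℤ j)
  fromℤ-equal? i j with i ℤ.≟ j
  ... | yes ≡.refl = just refl
  ... | no _       = nothing

  open import Algebra.Solver.Ring ℤ.+-*-rawRing (fromCommutativeRing R) ℤ⟶R fromℤ-equal? public

module _ {q : ℕ} (F : FiniteField q) where
  open FiniteField F
  open IntegerCoefficientSolver cring using (solve; _:=_; Polynomial; _:+_; _:*_; :-_; _:-_; con)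
  open import Relation.Binary.Reasoning.Setoid setoid
  open import Algebra.Properties.Group +-group using (⁻¹-involutive; ε⁻¹≈ε)
  open import Algebra.Properties.Ring ring using (-‿distribˡ-*)

  infixr 7 _⊙_
  infix  7 _∙_
  infix  4 _≈v_ _~_

  _⊙_ : Mat3 F → Vec3 F → Vec3 F
  _⊙_ = _·v_ F

  _~_ : Vec3 F → Vec3 F → Set
  _~_ = SamePoint F

  _≈v_ : Vec3 F → Vec3 F → Set
  u ≈v v = ∀ i → u i ≈ v i

  _∙_ : Vec3 F → Vec3 F → Carrier
  u ∙ v = sum3 F (λ k → u k * v k)

  col : Mat3 F → Fin 3 → Vec3 F
  col S l i = S i l

  transpose : Mat3 F → Mat3 F
  transpose S i j = S j i

  dotₚ : ∀ {n} (x₀ x₁ x₂ y₀ y₁ y₂ : Polynomial n) → Polynomial n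
  dotₚ x₀ x₁ x₂ y₀ y₁ y₂ = x₀ :* y₀ :+ x₁ :* y₁ :+ x₂ :* y₂

  evalₚ : ∀ {n} (a b c d e f x y z : Polynomial n) → Polynomial n
  evalₚ a b c d e f x y z =
    a :* (x :* x) :+ b :* (y :* y) :+ c :* (z :* z) :+ d :* (x :* y) :+ e :* (x :* z) :+ f :* (y :* z)

  diagₚ : ∀ {n} (a b c x y z : Polynomial n) → Polynomial n
  diagₚ a b c = evalₚ a b c (con (+ 0)) (con (+ 0)) (con (+ 0))

  polarₚ : ∀ {n} (a b c d e f x₀ x₁ x₂ y₀ y₁ y₂ : Polynomial n) → Polynomial n
  polarₚ a b c d e f x₀ x₁ x₂ y₀ y₁ y₂ =
    evalₚ a b c d e f (x₀ :+ y₀) (x₁ :+ y₁) (x₂ :+ y₂) :- evalₚ a b c d e f x₀ x₁ x₂ :- evalₚ a b c d e f y₀ y₁ y₂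

  det3ₚ : ∀ {n} (m₀₀ m₀₁ m₀₂ m₁₀ m₁₁ m₁₂ m₂₀ m₂₁ m₂₂ : Polynomial n) → Polynomial n
  det3ₚ m₀₀ m₀₁ m₀₂ m₁₀ m₁₁ m₁₂ m₂₀ m₂₁ m₂₂ =
    m₀₀ :* (m₁₁ :* m₂₂ :- m₁₂ :* m₂₁) :- m₀₁ :* (m₁₀ :* m₂₂ :- m₁₂ :* m₂₀) :+ m₀₂ :* (m₁₀ :* m₂₁ :- m₁₁ :* m₂₀)

  -- Field arithmetic

  x≈x+y-y : ∀ x y → x ≈ x + y - y
  x≈x+y-y = solve 2 (λ x y → x := x :+ y :- y) refl

  x≈x-y+y : ∀ x y → x ≈ x - y + y
  x≈x-y+y = solve 2 (λ x y → x := x :- y :+ y) refl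

  x-y≈0⇒x≈y : ∀ {x y} → x - y ≈ 0# → x ≈ y
  x-y≈0⇒x≈y {x} {y} x-y≈0 = trans (x≈x-y+y x y) (trans (+-congʳ x-y≈0) (+-identityˡ y))

  x+y≈0⇒x≈-y : ∀ {x y} → x + y ≈ 0# → x ≈ - y
  x+y≈0⇒x≈-y {x} {y} x+y≈0 = trans (x≈x+y-y x y) (trans (+-congʳ x+y≈0) (+-identityˡ _))

  -x≈0⇒x≈0 : ∀ {x} → - x ≈ 0# → x ≈ 0#
  -x≈0⇒x≈0 {x} -x≈0 = trans (sym (⁻¹-involutive x)) (trans (-‿cong -x≈0) ε⁻¹≈ε)

  *-cancelˡ-≈0 : ∀ {a b} → ¬ a ≈ 0# → a * b ≈ 0# → b ≈ 0#
  *-cancelˡ-≈0 {a} {b} a≉0 ab≈0 with inverse a a≉0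
  ... | a⁻¹ , aa⁻¹≈1 = begin
    b                ≈⟨ *-identityˡ b ⟨
    1# * b           ≈⟨ *-congʳ aa⁻¹≈1 ⟨
    a * a⁻¹ * b      ≈⟨ solve 3 (λ a a⁻¹ b → a :* a⁻¹ :* b := a⁻¹ :* (a :* b)) refl a a⁻¹ b ⟩
    a⁻¹ * (a * b)    ≈⟨ *-congˡ ab≈0 ⟩
    a⁻¹ * 0#         ≈⟨ zeroʳ a⁻¹ ⟩
    0#               ∎

  zero-product : ∀ {a b} → a * b ≈ 0# → a ≈ 0# ⊎ b ≈ 0#
  zero-product {a} ab≈0 with a ≟ 0#
  ... | yes a≈0 = inj₁ a≈0
  ... | no  a≉0 = inj₂ (*-cancelˡ-≈0 a≉0 ab≈0)

  nonzero-product : ∀ {a b} → ¬ a ≈ 0# → ¬ b ≈ 0# → ¬ a * b ≈ 0#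
  nonzero-product a≉0 b≉0 ab≈0 = b≉0 (*-cancelˡ-≈0 a≉0 ab≈0)

  x≈-x⇒x≈0 : ¬ two F ≈ 0# → ∀ {x} → x ≈ - x → x ≈ 0#
  x≈-x⇒x≈0 2≉0 {x} x≈-x = *-cancelˡ-≈0 2≉0 (begin
    two F * x   ≈⟨ solve 1 (λ x → con (+ 2) :* x := x :+ x) refl x ⟩
    x + x       ≈⟨ +-congˡ x≈-x ⟩
    x - x       ≈⟨ -‿inverseʳ x ⟩
    0#          ∎)

  -- Points of the projective plane

  ~-trans : ∀ {u v w} → u ~ v → v ~ w → u ~ w
  ~-trans (t , u≈tv) (s , v≈sw) = t * s , λ i →
    trans (u≈tv i) (trans (*-congˡ (v≈sw i)) (sym (*-assoc t s _)))

  ~-sym : ∀ {u v} → NonzeroVec F u → u ~ v → v ~ u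
  ~-sym {u} {v} u≉0 (t , u≈tv) with t ≟ 0#
  ... | yes t≈0 = ⊥-elim (u≉0 λ i → trans (u≈tv i) (trans (*-congʳ t≈0) (zeroˡ _)))
  ... | no  t≉0 with inverse t t≉0
  ... | t⁻¹ , tt⁻¹≈1 = t⁻¹ , λ i → begin
    v i               ≈⟨ *-identityˡ (v i) ⟨
    1# * v i          ≈⟨ *-congʳ tt⁻¹≈1 ⟨
    t * t⁻¹ * v i     ≈⟨ solve 3 (λ t t⁻¹ x → t :* t⁻¹ :* x := t⁻¹ :* (t :* x)) refl t t⁻¹ (v i) ⟩
    t⁻¹ * (t * v i)   ≈⟨ *-congˡ (u≈tv i) ⟨
    t⁻¹ * u i         ∎

  ~-vanishing : ∀ {u v} k → u ~ v → v k ≈ 0# → u k ≈ 0#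
  ~-vanishing k (t , u≈tv) vk≈0 = trans (u≈tv k) (trans (*-congˡ vk≈0) (zeroʳ t))

  -- Matrices acting on vectors

  ∙-cong : ∀ {u u′ v v′} → u ≈v u′ → v ≈v v′ → u ∙ v ≈ u′ ∙ v′
  ∙-cong u≈u′ v≈v′ = +-cong (+-cong (*-cong (u≈u′ i₀) (v≈v′ i₀)) (*-cong (u≈u′ i₁) (v≈v′ i₁)))
                            (*-cong (u≈u′ i₂) (v≈v′ i₂))

  ∙-zeroʳ : ∀ u {v} → v ≈v (λ _ → 0#) → u ∙ v ≈ 0#
  ∙-zeroʳ u v≈0 = trans (∙-cong {u} (λ _ → refl) v≈0)
    (solve 3 (λ x₀ x₁ x₂ → dotₚ x₀ x₁ x₂ (con (+ 0)) (con (+ 0)) (con (+ 0)) := con (+ 0)) refl (u i₀) (u i₁) (u i₂))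

  unit-∙ : ∀ l v → unit F l ∙ v ≈ v l
  unit-∙ i₀ v = solve 3 (λ y₀ y₁ y₂ → dotₚ (con (+ 1)) (con (+ 0)) (con (+ 0)) y₀ y₁ y₂ := y₀) refl (v i₀) (v i₁) (v i₂)
  unit-∙ i₁ v = solve 3 (λ y₀ y₁ y₂ → dotₚ (con (+ 0)) (con (+ 1)) (con (+ 0)) y₀ y₁ y₂ := y₁) refl (v i₀) (v i₁) (v i₂)
  unit-∙ i₂ v = solve 3 (λ y₀ y₁ y₂ → dotₚ (con (+ 0)) (con (+ 0)) (con (+ 1)) y₀ y₁ y₂ := y₂) refl (v i₀) (v i₁) (v i₂)

  unit-diagonal : ∀ l → unit F l l ≈ 1#
  unit-diagonal i₀ = refl
  unit-diagonal i₁ = refl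
  unit-diagonal i₂ = refl

  ·v-cong : ∀ S {u v} → u ≈v v → S ⊙ u ≈v S ⊙ v
  ·v-cong S u≈v i = ∙-cong {S i} (λ _ → refl) u≈v

  ·v-zero : ∀ S {u} → u ≈v (λ _ → 0#) → S ⊙ u ≈v (λ _ → 0#)
  ·v-zero S u≈0 i = ∙-zeroʳ (S i) u≈0

  ·v-scale : ∀ S t v → S ⊙ (λ k → t * v k) ≈v (λ i → t * (S ⊙ v) i)
  ·v-scale S t v i = solve 7 (λ s₀ s₁ s₂ t x₀ x₁ x₂ →
      dotₚ s₀ s₁ s₂ (t :* x₀) (t :* x₁) (t :* x₂) := t :* dotₚ s₀ s₁ s₂ x₀ x₁ x₂)
    refl (S i i₀) (S i i₁) (S i i₂) t (v i₀) (v i₁) (v i₂)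

  ·v-+ : ∀ S u v → S ⊙ (_+v_ F u v) ≈v (λ i → (S ⊙ u) i + (S ⊙ v) i)
  ·v-+ S u v i = solve 9 (λ s₀ s₁ s₂ x₀ x₁ x₂ y₀ y₁ y₂ →
      dotₚ s₀ s₁ s₂ (x₀ :+ y₀) (x₁ :+ y₁) (x₂ :+ y₂) := dotₚ s₀ s₁ s₂ x₀ x₁ x₂ :+ dotₚ s₀ s₁ s₂ y₀ y₁ y₂)
    refl (S i i₀) (S i i₁) (S i i₂) (u i₀) (u i₁) (u i₂) (v i₀) (v i₁) (v i₂)

  ·v-unit : ∀ S l → S ⊙ unit F l ≈v col S l
  ·v-unit S l i = trans (∙-comm (S i) (unit F l)) (unit-∙ l (λ k → S i k))
    where
    ∙-comm : ∀ u v → u ∙ v ≈ v ∙ u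
    ∙-comm u v = solve 6 (λ x₀ x₁ x₂ y₀ y₁ y₂ → dotₚ x₀ x₁ x₂ y₀ y₁ y₂ := dotₚ y₀ y₁ y₂ x₀ x₁ x₂)
      refl (u i₀) (u i₁) (u i₂) (v i₀) (v i₁) (v i₂)

  ·v-·m : ∀ A B v → A ⊙ (B ⊙ v) ≈v (_·m_ F A B) ⊙ v
  ·v-·m A B v i = solve 15 (λ a₀ a₁ a₂ b₀₀ b₀₁ b₀₂ b₁₀ b₁₁ b₁₂ b₂₀ b₂₁ b₂₂ x₀ x₁ x₂ →
      dotₚ a₀ a₁ a₂ (dotₚ b₀₀ b₀₁ b₀₂ x₀ x₁ x₂) (dotₚ b₁₀ b₁₁ b₁₂ x₀ x₁ x₂) (dotₚ b₂₀ b₂₁ b₂₂ x₀ x₁ x₂)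
      := dotₚ (dotₚ a₀ a₁ a₂ b₀₀ b₁₀ b₂₀) (dotₚ a₀ a₁ a₂ b₀₁ b₁₁ b₂₁) (dotₚ a₀ a₁ a₂ b₀₂ b₁₂ b₂₂) x₀ x₁ x₂)
    refl (A i i₀) (A i i₁) (A i i₂) (B i₀ i₀) (B i₀ i₁) (B i₀ i₂) (B i₁ i₀) (B i₁ i₁) (B i₁ i₂)
         (B i₂ i₀) (B i₂ i₁) (B i₂ i₂) (v i₀) (v i₁) (v i₂)

  idM-·v : ∀ v → idM F ⊙ v ≈v v
  idM-·v v i₀ = unit-∙ i₀ v
  idM-·v v i₁ = unit-∙ i₁ v
  idM-·v v i₂ = unit-∙ i₂ v

  ·v-inverse : ∀ {A B} → _≈M_ F (_·m_ F A B) (idM F) → ∀ v → A ⊙ (B ⊙ v) ≈v v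
  ·v-inverse {A} {B} AB≈1 v i = begin
    (A ⊙ (B ⊙ v)) i        ≈⟨ ·v-·m A B v i ⟩
    (_·m_ F A B ⊙ v) i     ≈⟨ ∙-cong {_·m_ F A B i} {v = v} (AB≈1 i) (λ _ → refl) ⟩
    (idM F ⊙ v) i          ≈⟨ idM-·v v i ⟩
    v i                    ∎

  ·v-adjoint : ∀ S w y → (S ⊙ w) ∙ y ≈ w ∙ (transpose S ⊙ y)
  ·v-adjoint S w y = solve 15 (λ s₀₀ s₀₁ s₀₂ s₁₀ s₁₁ s₁₂ s₂₀ s₂₁ s₂₂ w₀ w₁ w₂ y₀ y₁ y₂ →
      dotₚ (dotₚ s₀₀ s₀₁ s₀₂ w₀ w₁ w₂) (dotₚ s₁₀ s₁₁ s₁₂ w₀ w₁ w₂) (dotₚ s₂₀ s₂₁ s₂₂ w₀ w₁ w₂) y₀ y₁ y₂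
      := dotₚ w₀ w₁ w₂ (dotₚ s₀₀ s₁₀ s₂₀ y₀ y₁ y₂) (dotₚ s₀₁ s₁₁ s₂₁ y₀ y₁ y₂) (dotₚ s₀₂ s₁₂ s₂₂ y₀ y₁ y₂))
    refl (S i₀ i₀) (S i₀ i₁) (S i₀ i₂) (S i₁ i₀) (S i₁ i₁) (S i₁ i₂) (S i₂ i₀) (S i₂ i₁) (S i₂ i₂)
         (w i₀) (w i₁) (w i₂) (y i₀) (y i₁) (y i₂)

  transpose-kernel : ∀ {S T} → _≈M_ F (_·m_ F S T) (idM F) →
                     ∀ {y} → transpose S ⊙ y ≈v (λ _ → 0#) → y ≈v (λ _ → 0#)
  transpose-kernel {S} {T} ST≈1 {y} Sᵀy≈0 l = begin
    y l                                 ≈⟨ unit-∙ l y ⟨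
    unit F l ∙ y                        ≈⟨ ∙-cong {v = y} (·v-inverse {S} {T} ST≈1 (unit F l)) (λ _ → refl) ⟨
    (S ⊙ (T ⊙ unit F l)) ∙ y            ≈⟨ ·v-adjoint S (T ⊙ unit F l) y ⟩
    (T ⊙ unit F l) ∙ (transpose S ⊙ y)  ≈⟨ ∙-zeroʳ (T ⊙ unit F l) Sᵀy≈0 ⟩
    0#                                  ∎

  adjugate : Mat3 F → Mat3 F
  adjugate M i₀ i₀ = M i₁ i₁ * M i₂ i₂ - M i₁ i₂ * M i₂ i₁
  adjugate M i₀ i₁ = - (M i₀ i₁ * M i₂ i₂ - M i₀ i₂ * M i₂ i₁)
  adjugate M i₀ i₂ = M i₀ i₁ * M i₁ i₂ - M i₀ i₂ * M i₁ i₁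
  adjugate M i₁ i₀ = - (M i₁ i₀ * M i₂ i₂ - M i₁ i₂ * M i₂ i₀)
  adjugate M i₁ i₁ = M i₀ i₀ * M i₂ i₂ - M i₀ i₂ * M i₂ i₀
  adjugate M i₁ i₂ = - (M i₀ i₀ * M i₁ i₂ - M i₀ i₂ * M i₁ i₀)
  adjugate M i₂ i₀ = M i₁ i₀ * M i₂ i₁ - M i₁ i₁ * M i₂ i₀
  adjugate M i₂ i₁ = - (M i₀ i₀ * M i₂ i₁ - M i₀ i₁ * M i₂ i₀)
  adjugate M i₂ i₂ = M i₀ i₀ * M i₁ i₁ - M i₀ i₁ * M i₁ i₀

  adjugate-·v : ∀ M u → adjugate M ⊙ (M ⊙ u) ≈v (λ a → det3 F M * u a)
  adjugate-·v M u i₀ = solve 12 (λ m₀₀ m₀₁ m₀₂ m₁₀ m₁₁ m₁₂ m₂₀ m₂₁ m₂₂ x₀ x₁ x₂ →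
      dotₚ (m₁₁ :* m₂₂ :- m₁₂ :* m₂₁) (:- (m₀₁ :* m₂₂ :- m₀₂ :* m₂₁)) (m₀₁ :* m₁₂ :- m₀₂ :* m₁₁)
           (dotₚ m₀₀ m₀₁ m₀₂ x₀ x₁ x₂) (dotₚ m₁₀ m₁₁ m₁₂ x₀ x₁ x₂) (dotₚ m₂₀ m₂₁ m₂₂ x₀ x₁ x₂)
      := det3ₚ m₀₀ m₀₁ m₀₂ m₁₀ m₁₁ m₁₂ m₂₀ m₂₁ m₂₂ :* x₀)
    refl (M i₀ i₀) (M i₀ i₁) (M i₀ i₂) (M i₁ i₀) (M i₁ i₁) (M i₁ i₂) (M i₂ i₀) (M i₂ i₁) (M i₂ i₂)
         (u i₀) (u i₁) (u i₂)
  adjugate-·v M u i₁ = solve 12 (λ m₀₀ m₀₁ m₀₂ m₁₀ m₁₁ m₁₂ m₂₀ m₂₁ m₂₂ x₀ x₁ x₂ →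
      dotₚ (:- (m₁₀ :* m₂₂ :- m₁₂ :* m₂₀)) (m₀₀ :* m₂₂ :- m₀₂ :* m₂₀) (:- (m₀₀ :* m₁₂ :- m₀₂ :* m₁₀))
           (dotₚ m₀₀ m₀₁ m₀₂ x₀ x₁ x₂) (dotₚ m₁₀ m₁₁ m₁₂ x₀ x₁ x₂) (dotₚ m₂₀ m₂₁ m₂₂ x₀ x₁ x₂)
      := det3ₚ m₀₀ m₀₁ m₀₂ m₁₀ m₁₁ m₁₂ m₂₀ m₂₁ m₂₂ :* x₁)
    refl (M i₀ i₀) (M i₀ i₁) (M i₀ i₂) (M i₁ i₀) (M i₁ i₁) (M i₁ i₂) (M i₂ i₀) (M i₂ i₁) (M i₂ i₂)
         (u i₀) (u i₁) (u i₂)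
  adjugate-·v M u i₂ = solve 12 (λ m₀₀ m₀₁ m₀₂ m₁₀ m₁₁ m₁₂ m₂₀ m₂₁ m₂₂ x₀ x₁ x₂ →
      dotₚ (m₁₀ :* m₂₁ :- m₁₁ :* m₂₀) (:- (m₀₀ :* m₂₁ :- m₀₁ :* m₂₀)) (m₀₀ :* m₁₁ :- m₀₁ :* m₁₀)
           (dotₚ m₀₀ m₀₁ m₀₂ x₀ x₁ x₂) (dotₚ m₁₀ m₁₁ m₁₂ x₀ x₁ x₂) (dotₚ m₂₀ m₂₁ m₂₂ x₀ x₁ x₂)
      := det3ₚ m₀₀ m₀₁ m₀₂ m₁₀ m₁₁ m₁₂ m₂₀ m₂₁ m₂₂ :* x₂)
    refl (M i₀ i₀) (M i₀ i₁) (M i₀ i₂) (M i₁ i₀) (M i₁ i₁) (M i₁ i₂) (M i₂ i₀) (M i₂ i₁) (M i₂ i₂)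
         (u i₀) (u i₁) (u i₂)

  det3≉0⇒kernel-trivial : ∀ {M u} → ¬ det3 F M ≈ 0# → M ⊙ u ≈v (λ _ → 0#) → u ≈v (λ _ → 0#)
  det3≉0⇒kernel-trivial {M} {u} det≉0 Mu≈0 a = *-cancelˡ-≈0 det≉0 (begin
    det3 F M * u a                 ≈⟨ adjugate-·v M u a ⟨
    (adjugate M ⊙ (M ⊙ u)) a       ≈⟨ ·v-zero (adjugate M) Mu≈0 a ⟩
    0#                             ∎)

  -- Quadratic forms

  eval-cong : ∀ E {u v} → u ≈v v → eval F E u ≈ eval F E v
  eval-cong (qform a b c d e f) u≈v =
    +-cong (+-cong (+-cong (+-cong (+-cong (*-congˡ (*-cong x x)) (*-congˡ (*-cong y y)))
      (*-congˡ (*-cong z z))) (*-congˡ (*-cong x y))) (*-congˡ (*-cong x z))) (*-congˡ (*-cong y z))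
    where
    x = u≈v i₀
    y = u≈v i₁
    z = u≈v i₂

  polar : QForm F → Vec3 F → Vec3 F → Carrier
  polar E u v = eval F E (_+v_ F u v) - eval F E u - eval F E v

  polar-comm : ∀ E u v → polar E u v ≈ polar E v u
  polar-comm (qform a b c d e f) u v = solve 12 (λ a b c d e f x₀ x₁ x₂ y₀ y₁ y₂ →
      polarₚ a b c d e f x₀ x₁ x₂ y₀ y₁ y₂ := polarₚ a b c d e f y₀ y₁ y₂ x₀ x₁ x₂)
    refl a b c d e f (u i₀) (u i₁) (u i₂) (v i₀) (v i₁) (v i₂)

  polar-self : ∀ E u → polar E u u ≈ two F * eval F E u
  polar-self (qform a b c d e f) u = solve 9 (λ a b c d e f x₀ x₁ x₂ →
      polarₚ a b c d e f x₀ x₁ x₂ x₀ x₁ x₂ := con (+ 2) :* evalₚ a b c d e f x₀ x₁ x₂)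
    refl a b c d e f (u i₀) (u i₁) (u i₂)

  polar-symMat : ∀ E u v → polar E u v ≈ u ∙ (symMat F E ⊙ v)
  polar-symMat (qform a b c d e f) u v = solve 12 (λ a b c d e f x₀ x₁ x₂ y₀ y₁ y₂ →
      polarₚ a b c d e f x₀ x₁ x₂ y₀ y₁ y₂
      := dotₚ x₀ x₁ x₂ (dotₚ (con (+ 2) :* a) d e y₀ y₁ y₂) (dotₚ d (con (+ 2) :* b) f y₀ y₁ y₂)
                       (dotₚ e f (con (+ 2) :* c) y₀ y₁ y₂))
    refl a b c d e f (u i₀) (u i₁) (u i₂) (v i₀) (v i₁) (v i₂)

  _∘ᶠ_ : QForm F → Mat3 F → QForm F
  E ∘ᶠ S = qform (eval F E (col S i₀)) (eval F E (col S i₁)) (eval F E (col S i₂))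
                 (polar E (col S i₀) (col S i₁)) (polar E (col S i₀) (col S i₂)) (polar E (col S i₁) (col S i₂))

  eval-∘ᶠ : ∀ E S v → eval F E (S ⊙ v) ≈ eval F (E ∘ᶠ S) v
  eval-∘ᶠ (qform a b c d e f) S v = solve 18 (λ a b c d e f s₀₀ s₀₁ s₀₂ s₁₀ s₁₁ s₁₂ s₂₀ s₂₁ s₂₂ x₀ x₁ x₂ →
      evalₚ a b c d e f (dotₚ s₀₀ s₀₁ s₀₂ x₀ x₁ x₂) (dotₚ s₁₀ s₁₁ s₁₂ x₀ x₁ x₂) (dotₚ s₂₀ s₂₁ s₂₂ x₀ x₁ x₂)
      := evalₚ (evalₚ a b c d e f s₀₀ s₁₀ s₂₀) (evalₚ a b c d e f s₀₁ s₁₁ s₂₁) (evalₚ a b c d e f s₀₂ s₁₂ s₂₂)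
               (polarₚ a b c d e f s₀₀ s₁₀ s₂₀ s₀₁ s₁₁ s₂₁) (polarₚ a b c d e f s₀₀ s₁₀ s₂₀ s₀₂ s₁₂ s₂₂)
               (polarₚ a b c d e f s₀₁ s₁₁ s₂₁ s₀₂ s₁₂ s₂₂) x₀ x₁ x₂)
    refl a b c d e f (S i₀ i₀) (S i₀ i₁) (S i₀ i₂) (S i₁ i₀) (S i₁ i₁) (S i₁ i₂) (S i₂ i₀) (S i₂ i₁) (S i₂ i₂)
         (v i₀) (v i₁) (v i₂)

  crossCoeff-∘ : ∀ E S l m → crossCoeff F (λ v → eval F E (S ⊙ v)) l m ≈ polar E (col S l) (col S m)
  crossCoeff-∘ E S l m = +-cong (+-cong (eval-cong E S[eₗ+eₘ]≈cₗ+cₘ) (-‿cong (eval-cong E (·v-unit S l))))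
                                (-‿cong (eval-cong E (·v-unit S m)))
    where
    S[eₗ+eₘ]≈cₗ+cₘ : S ⊙ _+v_ F (unit F l) (unit F m) ≈v _+v_ F (col S l) (col S m)
    S[eₗ+eₘ]≈cₗ+cₘ i = trans (·v-+ S (unit F l) (unit F m) i) (+-cong (·v-unit S l i) (·v-unit S m i))

  diagForm : (Fin 3 → Carrier) → QForm F
  diagForm κ = qform (κ i₀) (κ i₁) (κ i₂) 0# 0# 0#

  diagCoeff : QForm F → Mat3 F → Fin 3 → Carrier
  diagCoeff E S l = eval F E (col S l)

  diagonalUnder⇒polar≈0 : ∀ {E S} → DiagonalUnder F S E →
    polar E (col S i₀) (col S i₁) ≈ 0# × polar E (col S i₀) (col S i₂) ≈ 0# × polar E (col S i₁) (col S i₂) ≈ 0#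
  diagonalUnder⇒polar≈0 {E} {S} (c₀₁≈0 , c₀₂≈0 , c₁₂≈0) = vanish i₀ i₁ c₀₁≈0 , vanish i₀ i₂ c₀₂≈0 , vanish i₁ i₂ c₁₂≈0
    where
    vanish : ∀ l m → crossCoeff F (λ v → eval F E (S ⊙ v)) l m ≈ 0# → polar E (col S l) (col S m) ≈ 0#
    vanish l m c≈0 = trans (sym (crossCoeff-∘ E S l m)) c≈0

  diagonalize : ∀ {E S} → DiagonalUnder F S E → ∀ v → eval F E (S ⊙ v) ≈ eval F (diagForm (diagCoeff E S)) v
  diagonalize {E} {S} diag v =
    let p₀₁≈0 , p₀₂≈0 , p₁₂≈0 = diagonalUnder⇒polar≈0 {E} {S} diag
    in trans (eval-∘ᶠ E S v) (+-cong (+-cong (+-congˡ (*-congʳ p₀₁≈0)) (*-congʳ p₀₂≈0)) (*-congʳ p₁₂≈0))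

  proper⇒two≉0 : ∀ {E} → Proper F E → ¬ two F ≈ 0#
  proper⇒two≉0 {qform a b c d e f} (_ , det≉0) 2≈0 = det≉0 (begin
    det3 F (symMat F (qform a b c d e f))
      ≈⟨ solve 6 (λ a b c d e f →
           det3ₚ (con (+ 2) :* a) d e d (con (+ 2) :* b) f e f (con (+ 2) :* c)
           := con (+ 2) :* (con (+ 4) :* a :* b :* c :- a :* f :* f :- b :* e :* e :- c :* d :* d :+ d :* e :* f))
         refl a b c d e f ⟩
    two F * _  ≈⟨ *-congʳ 2≈0 ⟩
    0# * _     ≈⟨ zeroˡ _ ⟩
    0#         ∎)

  offDiagonal-polar : ∀ {E S} → DiagonalUnder F S E → ∀ l m → l ≢ m → polar E (col S l) (col S m) ≈ 0#
  offDiagonal-polar {E} {S} diag = go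
    where
    p₀₁≈0 = proj₁ (diagonalUnder⇒polar≈0 {E} {S} diag)
    p₀₂≈0 = proj₁ (proj₂ (diagonalUnder⇒polar≈0 {E} {S} diag))
    p₁₂≈0 = proj₂ (proj₂ (diagonalUnder⇒polar≈0 {E} {S} diag))
    swap : ∀ l m → polar E (col S l) (col S m) ≈ 0# → polar E (col S m) (col S l) ≈ 0#
    swap l m p≈0 = trans (polar-comm E (col S m) (col S l)) p≈0
    go : ∀ l m → l ≢ m → polar E (col S l) (col S m) ≈ 0#
    go i₀ i₁ _ = p₀₁≈0
    go i₀ i₂ _ = p₀₂≈0
    go i₁ i₂ _ = p₁₂≈0
    go i₁ i₀ _ = swap i₀ i₁ p₀₁≈0
    go i₂ i₀ _ = swap i₀ i₂ p₀₂≈0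
    go i₂ i₁ _ = swap i₁ i₂ p₁₂≈0
    go i₀ i₀ l≢m = ⊥-elim (l≢m ≡.refl)
    go i₁ i₁ l≢m = ⊥-elim (l≢m ≡.refl)
    go i₂ i₂ l≢m = ⊥-elim (l≢m ≡.refl)

  -- If E (S eₗ) vanished, the column S eₗ would be polar to every column of S, hence
  -- (as S is invertible) lie in the kernel of the nonsingular matrix symMat E.
  diagCoeff-nonzero : ∀ {E S T} → Proper F E → _≈M_ F (_·m_ F S T) (idM F) → _≈M_ F (_·m_ F T S) (idM F) →
                      DiagonalUnder F S E → ∀ l → ¬ diagCoeff E S l ≈ 0#
  diagCoeff-nonzero {E} {S} {T} (_ , det≉0) ST≈1 TS≈1 diag l Eₗ≈0 = 0≉1 (begin
    0#                        ≈⟨ ·v-zero T cₗ≈0 l ⟨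
    (T ⊙ col S l) l           ≈⟨ ·v-cong T (·v-unit S l) l ⟨
    (T ⊙ (S ⊙ unit F l)) l    ≈⟨ ·v-inverse {T} {S} TS≈1 (unit F l) l ⟩
    unit F l l                ≈⟨ unit-diagonal l ⟩
    1#                        ∎)
    where
    cₗ = col S l
    polar-cₗ : ∀ m → polar E (col S m) cₗ ≈ 0#
    polar-cₗ m with m Fin.≟ l
    ... | yes ≡.refl = trans (polar-self E cₗ) (trans (*-congˡ Eₗ≈0) (zeroʳ _))
    ... | no  m≢l    = offDiagonal-polar {E} {S} diag m l m≢l
    Mcₗ≈0 : symMat F E ⊙ cₗ ≈v (λ _ → 0#)
    Mcₗ≈0 = transpose-kernel {S} {T} ST≈1 (λ m → trans (sym (polar-symMat E (col S m) cₗ)) (polar-cₗ m))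
    cₗ≈0 : cₗ ≈v (λ _ → 0#)
    cₗ≈0 = det3≉0⇒kernel-trivial {symMat F E} {cₗ} det≉0 Mcₗ≈0

  -- Change of coordinates

  ~-map : ∀ A {u v} → u ~ v → (A ⊙ u) ~ (A ⊙ v)
  ~-map A {u} {v} (t , u≈tv) = t , λ i → trans (·v-cong A u≈tv i) (·v-scale A t v i)

  ≈v-~ : ∀ {u u′ w} → u ≈v u′ → u′ ~ w → u ~ w
  ≈v-~ u≈u′ (t , u′≈tw) = t , λ i → trans (u≈u′ i) (u′≈tw i)

  ~-≈v : ∀ {u w w′} → u ~ w → w ≈v w′ → u ~ w′
  ~-≈v (t , u≈tw) w≈w′ = t , λ i → trans (u≈tw i) (*-congˡ (w≈w′ i))

  meetInThree-pullback : ∀ {E₁ E₂ D₁ D₂ S T} → (∀ v → S ⊙ (T ⊙ v) ≈v v) → (∀ v → T ⊙ (S ⊙ v) ≈v v) →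
                         (∀ v → eval F E₁ (S ⊙ v) ≈ eval F D₁ v) → (∀ v → eval F E₂ (S ⊙ v) ≈ eval F D₂ v) →
                         MeetInExactlyThreePoints F E₁ E₂ → MeetInExactlyThreePoints F D₁ D₂
  meetInThree-pullback {E₁} {E₂} {D₁} {D₂} {S} {T} STv≈v TSv≈v E₁S≈D₁ E₂S≈D₂
    (p₁ , p₂ , p₃ , on₁ , on₂ , on₃ , p₁≁p₂ , p₁≁p₃ , p₂≁p₃ , cover) =
    T ⊙ p₁ , T ⊙ p₂ , T ⊙ p₃ , pull on₁ , pull on₂ , pull on₃ ,
    ≁-pull p₁≁p₂ , ≁-pull p₁≁p₃ , ≁-pull p₂≁p₃ , cover′
    where
    pull : ∀ {p} → OnBoth F E₁ E₂ p → OnBoth F D₁ D₂ (T ⊙ p)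
    pull {p} (p≉0 , E₁p≈0 , E₂p≈0) =
      (λ Tp≈0 → p≉0 λ i → trans (sym (STv≈v p i)) (·v-zero S Tp≈0 i)) ,
      trans (sym (E₁S≈D₁ (T ⊙ p))) (trans (eval-cong E₁ (STv≈v p)) E₁p≈0) ,
      trans (sym (E₂S≈D₂ (T ⊙ p))) (trans (eval-cong E₂ (STv≈v p)) E₂p≈0)
    push : ∀ {v} → OnBoth F D₁ D₂ v → OnBoth F E₁ E₂ (S ⊙ v)
    push {v} (v≉0 , D₁v≈0 , D₂v≈0) =
      (λ Sv≈0 → v≉0 λ i → trans (sym (TSv≈v v i)) (·v-zero T Sv≈0 i)) ,
      trans (E₁S≈D₁ v) D₁v≈0 ,
      trans (E₂S≈D₂ v) D₂v≈0
    ≁-pull : ∀ {p p′} → ¬ p ~ p′ → ¬ (T ⊙ p) ~ (T ⊙ p′)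
    ≁-pull {p} {p′} p≁p′ Tp~Tp′ = p≁p′ (≈v-~ (λ i → sym (STv≈v p i)) (~-≈v (~-map S Tp~Tp′) (STv≈v p′)))
    ~-pull : ∀ {v p} → (S ⊙ v) ~ p → v ~ (T ⊙ p)
    ~-pull {v} Sv~p = ≈v-~ (λ i → sym (TSv≈v v i)) (~-map T Sv~p)
    cover′ : ∀ v → OnBoth F D₁ D₂ v → v ~ (T ⊙ p₁) ⊎ v ~ (T ⊙ p₂) ⊎ v ~ (T ⊙ p₃)
    cover′ v on = Sum.map ~-pull (Sum.map ~-pull ~-pull) (cover (S ⊙ v) (push on))

  -- Sign changes

  other₁ other₂ : Fin 3 → Fin 3
  other₁ i₀ = i₁
  other₁ i₁ = i₀
  other₁ i₂ = i₀
  other₂ i₀ = i₂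
  other₂ i₁ = i₂
  other₂ i₂ = i₁

  other₁≢ : ∀ k → other₁ k ≢ k
  other₁≢ i₀ ()
  other₁≢ i₁ ()
  other₁≢ i₂ ()

  other₂≢ : ∀ k → other₂ k ≢ k
  other₂≢ i₀ ()
  other₂≢ i₁ ()
  other₂≢ i₂ ()

  other₁≢other₂ : ∀ k → other₁ k ≢ other₂ k
  other₁≢other₂ i₀ ()
  other₁≢other₂ i₁ ()
  other₁≢other₂ i₂ ()

  fin3-elim : ∀ k {P : Fin 3 → Set} → P k → P (other₁ k) → P (other₂ k) → ∀ x → P x
  fin3-elim i₀ p p₁ p₂ i₀ = p
  fin3-elim i₀ p p₁ p₂ i₁ = p₁
  fin3-elim i₀ p p₁ p₂ i₂ = p₂
  fin3-elim i₁ p p₁ p₂ i₀ = p₁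
  fin3-elim i₁ p p₁ p₂ i₁ = p
  fin3-elim i₁ p p₁ p₂ i₂ = p₂
  fin3-elim i₂ p p₁ p₂ i₀ = p₁
  fin3-elim i₂ p p₁ p₂ i₁ = p₂
  fin3-elim i₂ p p₁ p₂ i₂ = p

  ≁-by-zero : ∀ {u v} k → ¬ u k ≈ 0# → v k ≈ 0# → ¬ u ~ v
  ≁-by-zero k uₖ≉0 vₖ≈0 u~v = uₖ≉0 (~-vanishing k u~v vₖ≈0)

  ≁-by-signs : ¬ two F ≈ 0# → ∀ {u u′} i j → u′ j ≈ u j → u′ i ≈ - u i →
               ¬ u i ≈ 0# → ¬ u j ≈ 0# → ¬ u ~ u′
  ≁-by-signs 2≉0 {u} {u′} i j agree oppose uᵢ≉0 uⱼ≉0 (t , u≈tu′) =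
    nonzero-product uᵢ≉0 uⱼ≉0 (trans fixed (x≈-x⇒x≈0 2≉0 (trans (sym fixed) negated)))
    where
    fixed : u i * u j ≈ t * (u i * u j)
    fixed = trans (*-congˡ (trans (u≈tu′ j) (*-congˡ agree)))
                  (solve 3 (λ x t y → x :* (t :* y) := t :* (x :* y)) refl (u i) t (u j))
    negated : u i * u j ≈ - (t * (u i * u j))
    negated = trans (*-congʳ (trans (u≈tu′ i) (*-congˡ oppose)))
                    (solve 3 (λ t x y → t :* (:- x) :* y := :- (t :* (x :* y))) refl t (u i) (u j))

  proportional : ∀ k {u w} → u k ≈ 0# → w k ≈ 0# → ¬ w (other₂ k) ≈ 0# →
                 u (other₁ k) * w (other₂ k) ≈ w (other₁ k) * u (other₂ k) → u ~ w
  proportional k {u} {w} uₖ≈0 wₖ≈0 wⱼ≉0 minor≈0 with inverse (w (other₂ k)) wⱼ≉0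
  ... | w⁻¹ , wⱼw⁻¹≈1 = t , fin3-elim k {λ x → u x ≈ t * w x} atₖ atᵢ atⱼ
    where
    i = other₁ k
    j = other₂ k
    t = u j * w⁻¹
    atₖ : u k ≈ t * w k
    atₖ = trans uₖ≈0 (sym (trans (*-congˡ wₖ≈0) (zeroʳ t)))
    atᵢ : u i ≈ t * w i
    atᵢ = begin
      u i                    ≈⟨ *-identityʳ (u i) ⟨
      u i * 1#               ≈⟨ *-congˡ wⱼw⁻¹≈1 ⟨
      u i * (w j * w⁻¹)      ≈⟨ *-assoc (u i) (w j) w⁻¹ ⟨
      u i * w j * w⁻¹        ≈⟨ *-congʳ minor≈0 ⟩
      w i * u j * w⁻¹        ≈⟨ solve 3 (λ a b c → a :* b :* c := b :* c :* a) refl (w i) (u j) w⁻¹ ⟩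
      t * w i                ∎
    atⱼ : u j ≈ t * w j
    atⱼ = begin
      u j                    ≈⟨ *-identityʳ (u j) ⟨
      u j * 1#               ≈⟨ *-congˡ wⱼw⁻¹≈1 ⟨
      u j * (w j * w⁻¹)      ≈⟨ solve 3 (λ a b c → a :* (b :* c) := a :* c :* b) refl (u j) (w j) w⁻¹ ⟩
      t * w j                ∎

  flip : Fin 3 → Vec3 F → Vec3 F
  flip l v x with l Fin.≟ x
  ... | yes _ = - v x
  ... | no  _ = v x

  flip-same : ∀ l v → flip l v l ≈ - v l
  flip-same l v with l Fin.≟ l
  ... | yes _   = refl
  ... | no  l≢l = ⊥-elim (l≢l ≡.refl)

  flip-other : ∀ l x v → l ≢ x → flip l v x ≈ v x
  flip-other l x v l≢x with l Fin.≟ x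
  ... | yes l≡x = ⊥-elim (l≢x l≡x)
  ... | no  _   = refl

  flip-vanishing : ∀ l x v → flip l v x ≈ 0# → v x ≈ 0#
  flip-vanishing l x v flip≈0 with l Fin.≟ x
  ... | yes _ = -x≈0⇒x≈0 flip≈0
  ... | no  _ = flip≈0

  flip-≁ : ¬ two F ≈ 0# → ∀ {v} l e → e ≢ l → ¬ v l ≈ 0# → ¬ v e ≈ 0# → ¬ v ~ flip l v
  flip-≁ 2≉0 {v} l e e≢l vₗ≉0 vₑ≉0 =
    ≁-by-signs 2≉0 l e (flip-other l e v (λ l≡e → e≢l (≡.sym l≡e))) (flip-same l v) vₗ≉0 vₑ≉0

  -- Diagonal conics

  binary-forms-difference : ∀ κᵢ κⱼ uᵢ uⱼ vᵢ vⱼ →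
    κᵢ * ((uᵢ * vⱼ - vᵢ * uⱼ) * (uᵢ * vⱼ + vᵢ * uⱼ)) ≈
    (κᵢ * (uᵢ * uᵢ) + κⱼ * (uⱼ * uⱼ)) * (vⱼ * vⱼ) - (κᵢ * (vᵢ * vᵢ) + κⱼ * (vⱼ * vⱼ)) * (uⱼ * uⱼ)
  binary-forms-difference = solve 6 (λ κᵢ κⱼ uᵢ uⱼ vᵢ vⱼ →
    κᵢ :* ((uᵢ :* vⱼ :- vᵢ :* uⱼ) :* (uᵢ :* vⱼ :+ vᵢ :* uⱼ))
    := (κᵢ :* (uᵢ :* uᵢ) :+ κⱼ :* (uⱼ :* uⱼ)) :* (vⱼ :* vⱼ) :- (κᵢ :* (vᵢ :* vᵢ) :+ κⱼ :* (vⱼ :* vⱼ)) :* (uⱼ :* uⱼ)) refl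

  eval-diagForm-around : ∀ κ v k → eval F (diagForm κ) v ≈
    κ (other₁ k) * (v (other₁ k) * v (other₁ k)) + κ (other₂ k) * (v (other₂ k) * v (other₂ k)) + κ k * (v k * v k)
  eval-diagForm-around κ v i₀ = solve 6 (λ k₀ k₁ k₂ x₀ x₁ x₂ →
      diagₚ k₀ k₁ k₂ x₀ x₁ x₂ := k₁ :* (x₁ :* x₁) :+ k₂ :* (x₂ :* x₂) :+ k₀ :* (x₀ :* x₀))
    refl (κ i₀) (κ i₁) (κ i₂) (v i₀) (v i₁) (v i₂)
  eval-diagForm-around κ v i₁ = solve 6 (λ k₀ k₁ k₂ x₀ x₁ x₂ →
      diagₚ k₀ k₁ k₂ x₀ x₁ x₂ := k₀ :* (x₀ :* x₀) :+ k₂ :* (x₂ :* x₂) :+ k₁ :* (x₁ :* x₁))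
    refl (κ i₀) (κ i₁) (κ i₂) (v i₀) (v i₁) (v i₂)
  eval-diagForm-around κ v i₂ = solve 6 (λ k₀ k₁ k₂ x₀ x₁ x₂ →
      diagₚ k₀ k₁ k₂ x₀ x₁ x₂ := k₀ :* (x₀ :* x₀) :+ k₁ :* (x₁ :* x₁) :+ k₂ :* (x₂ :* x₂))
    refl (κ i₀) (κ i₁) (κ i₂) (v i₀) (v i₁) (v i₂)

  eval-diagForm-flip : ∀ κ l v → eval F (diagForm κ) (flip l v) ≈ eval F (diagForm κ) v
  eval-diagForm-flip κ i₀ v = solve 6 (λ k₀ k₁ k₂ x₀ x₁ x₂ →
      diagₚ k₀ k₁ k₂ (:- x₀) x₁ x₂ := diagₚ k₀ k₁ k₂ x₀ x₁ x₂)
    refl (κ i₀) (κ i₁) (κ i₂) (v i₀) (v i₁) (v i₂)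
  eval-diagForm-flip κ i₁ v = solve 6 (λ k₀ k₁ k₂ x₀ x₁ x₂ →
      diagₚ k₀ k₁ k₂ x₀ (:- x₁) x₂ := diagₚ k₀ k₁ k₂ x₀ x₁ x₂)
    refl (κ i₀) (κ i₁) (κ i₂) (v i₀) (v i₁) (v i₂)
  eval-diagForm-flip κ i₂ v = solve 6 (λ k₀ k₁ k₂ x₀ x₁ x₂ →
      diagₚ k₀ k₁ k₂ x₀ x₁ (:- x₂) := diagₚ k₀ k₁ k₂ x₀ x₁ x₂)
    refl (κ i₀) (κ i₁) (κ i₂) (v i₀) (v i₁) (v i₂)

  module DiagonalConics (κ₁ κ₂ : Fin 3 → Carrier) (κ₁≉0 : ∀ l → ¬ κ₁ l ≈ 0#) (2≉0 : ¬ two F ≈ 0#) where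

    Common : Vec3 F → Set
    Common = OnBoth F (diagForm κ₁) (diagForm κ₂)

    Covered : Vec3 F → Vec3 F → Vec3 F → Set
    Covered A B C = ∀ v → Common v → v ~ A ⊎ v ~ B ⊎ v ~ C

    common-flip : ∀ l {v} → Common v → Common (flip l v)
    common-flip l {v} (v≉0 , E₁v≈0 , E₂v≈0) =
      (λ flip≈0 → v≉0 λ x → flip-vanishing l x v (flip≈0 x)) ,
      trans (eval-diagForm-flip κ₁ l v) E₁v≈0 ,
      trans (eval-diagForm-flip κ₂ l v) E₂v≈0

    square≈0 : ∀ (v : Vec3 F) l → v l ≈ 0# → κ₁ l * (v l * v l) ≈ 0#
    square≈0 v l vₗ≈0 = trans (*-congˡ (trans (*-congʳ vₗ≈0) (zeroˡ (v l)))) (zeroʳ (κ₁ l))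

    binary-vanishes : ∀ k {v} → Common v → v k ≈ 0# →
      κ₁ (other₁ k) * (v (other₁ k) * v (other₁ k)) + κ₁ (other₂ k) * (v (other₂ k) * v (other₂ k)) ≈ 0#
    binary-vanishes k {v} (_ , E₁v≈0 , _) vₖ≈0 = begin
      _                         ≈⟨ +-identityʳ _ ⟨
      _ + 0#                    ≈⟨ +-congˡ (square≈0 v k vₖ≈0) ⟨
      _ + κ₁ k * (v k * v k)    ≈⟨ eval-diagForm-around κ₁ v k ⟨
      eval F (diagForm κ₁) v    ≈⟨ E₁v≈0 ⟩
      0#                        ∎

    at-most-one-zero : ∀ k {v} → Common v → v (other₁ k) ≈ 0# → v (other₂ k) ≈ 0# → ⊥
    at-most-one-zero k {v} (v≉0 , E₁v≈0 , _) vᵢ≈0 vⱼ≈0 =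
      v≉0 (fin3-elim k {λ x → v x ≈ 0#} vₖ≈0 vᵢ≈0 vⱼ≈0)
      where
      κvₖ²≈0 : κ₁ k * (v k * v k) ≈ 0#
      κvₖ²≈0 = begin
        κ₁ k * (v k * v k)            ≈⟨ +-identityˡ _ ⟨
        0# + κ₁ k * (v k * v k)       ≈⟨ +-congʳ (trans (+-cong (square≈0 v _ vᵢ≈0) (square≈0 v _ vⱼ≈0)) (+-identityˡ 0#)) ⟨
        _ + _ + κ₁ k * (v k * v k)    ≈⟨ eval-diagForm-around κ₁ v k ⟨
        eval F (diagForm κ₁) v        ≈⟨ E₁v≈0 ⟩
        0#                            ∎
      vₖ≈0 : v k ≈ 0#
      vₖ≈0 = Sum.reduce (zero-product (*-cancelˡ-≈0 (κ₁≉0 k) κvₖ²≈0))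

    another-nonzero : ∀ {v} → Common v → ∀ k → Σ (Fin 3) λ e → e ≢ k × ¬ v e ≈ 0#
    another-nonzero {v} common k with v (other₁ k) ≟ 0# | v (other₂ k) ≟ 0#
    ... | no  vᵢ≉0 | _        = other₁ k , other₁≢ k , vᵢ≉0
    ... | yes _    | no  vⱼ≉0 = other₂ k , other₂≢ k , vⱼ≉0
    ... | yes vᵢ≈0 | yes vⱼ≈0 = ⊥-elim (at-most-one-zero k common vᵢ≈0 vⱼ≈0)

    ZeroPattern : Vec3 F → Set
    ZeroPattern v = (∀ x → ¬ v x ≈ 0#) ⊎
                    Σ (Fin 3) λ k → v k ≈ 0# × ¬ v (other₁ k) ≈ 0# × ¬ v (other₂ k) ≈ 0#

    zeroPattern : ∀ {v} → Common v → ZeroPattern v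
    zeroPattern {v} common with v i₀ ≟ 0# | v i₁ ≟ 0# | v i₂ ≟ 0#
    ... | no  v₀≉0 | no  v₁≉0 | no  v₂≉0 = inj₁ λ { i₀ → v₀≉0 ; i₁ → v₁≉0 ; i₂ → v₂≉0 }
    ... | yes v₀≈0 | no  v₁≉0 | no  v₂≉0 = inj₂ (i₀ , v₀≈0 , v₁≉0 , v₂≉0)
    ... | no  v₀≉0 | yes v₁≈0 | no  v₂≉0 = inj₂ (i₁ , v₁≈0 , v₀≉0 , v₂≉0)
    ... | no  v₀≉0 | no  v₁≉0 | yes v₂≈0 = inj₂ (i₂ , v₂≈0 , v₀≉0 , v₁≉0)
    ... | _        | yes v₁≈0 | yes v₂≈0 = ⊥-elim (at-most-one-zero i₀ common v₁≈0 v₂≈0)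
    ... | yes v₀≈0 | _        | yes v₂≈0 = ⊥-elim (at-most-one-zero i₁ common v₀≈0 v₂≈0)
    ... | yes v₀≈0 | yes v₁≈0 | _        = ⊥-elim (at-most-one-zero i₂ common v₀≈0 v₁≈0)

    minor-factor-vanishes : ∀ k {U V} → Common U → Common V → U k ≈ 0# → V k ≈ 0# →
      U (other₁ k) * V (other₂ k) - V (other₁ k) * U (other₂ k) ≈ 0# ⊎
      U (other₁ k) * V (other₂ k) + V (other₁ k) * U (other₂ k) ≈ 0#
    minor-factor-vanishes k {U} {V} cU cV Uₖ≈0 Vₖ≈0 = zero-product (*-cancelˡ-≈0 (κ₁≉0 i) (begin
        κ₁ i * ((U i * V j - V i * U j) * (U i * V j + V i * U j))
          ≈⟨ binary-forms-difference (κ₁ i) (κ₁ j) (U i) (U j) (V i) (V j) ⟩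
        (κ₁ i * (U i * U i) + κ₁ j * (U j * U j)) * (V j * V j) - (κ₁ i * (V i * V i) + κ₁ j * (V j * V j)) * (U j * U j)
          ≈⟨ +-cong (*-congʳ (binary-vanishes k cU Uₖ≈0)) (-‿cong (*-congʳ (binary-vanishes k cV Vₖ≈0))) ⟩
        0# * (V j * V j) - 0# * (U j * U j)
          ≈⟨ +-cong (zeroˡ _) (trans (-‿cong (zeroˡ _)) ε⁻¹≈ε) ⟩
        0# + 0#
          ≈⟨ +-identityʳ 0# ⟩
        0# ∎))
      where
      i = other₁ k
      j = other₂ k

    line-meets-twice : ∀ k {U V} → Common U → Common V → U k ≈ 0# → V k ≈ 0# → ¬ V (other₂ k) ≈ 0# →
                       U ~ V ⊎ U ~ flip (other₁ k) V
    line-meets-twice k {U} {V} cU cV Uₖ≈0 Vₖ≈0 Vⱼ≉0 =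
      Sum.map same-sign opposite-sign (minor-factor-vanishes k cU cV Uₖ≈0 Vₖ≈0)
      where
      i = other₁ k
      j = other₂ k
      same-sign : U i * V j - V i * U j ≈ 0# → U ~ V
      same-sign minus≈0 = proportional k Uₖ≈0 Vₖ≈0 Vⱼ≉0 (x-y≈0⇒x≈y minus≈0)
      V′ⱼ≈Vⱼ : flip i V j ≈ V j
      V′ⱼ≈Vⱼ = flip-other i j V (other₁≢other₂ k)
      opposite-sign : U i * V j + V i * U j ≈ 0# → U ~ flip i V
      opposite-sign plus≈0 = proportional k Uₖ≈0
        (trans (flip-other i k V (other₁≢ k)) Vₖ≈0)
        (λ V′ⱼ≈0 → Vⱼ≉0 (trans (sym V′ⱼ≈Vⱼ) V′ⱼ≈0))
        (begin
          U i * flip i V j   ≈⟨ *-congˡ V′ⱼ≈Vⱼ ⟩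
          U i * V j          ≈⟨ x+y≈0⇒x≈-y plus≈0 ⟩
          - (V i * U j)      ≈⟨ -‿distribˡ-* (V i) (U j) ⟩
          - V i * U j        ≈⟨ *-congʳ (flip-same i V) ⟨
          flip i V i * U j   ∎)

    signChanges : Vec3 F → Fin 4 → Vec3 F
    signChanges v zero    = v
    signChanges v (suc l) = flip l v

    signChanges-common : ∀ {v} → Common v → ∀ m → Common (signChanges v m)
    signChanges-common common zero    = common
    signChanges-common common (suc l) = common-flip l common

    signChanges-distinct : ∀ {v} → (∀ x → ¬ v x ≈ 0#) → ∀ {m n} → m Fin.< n → ¬ signChanges v m ~ signChanges v n
    signChanges-distinct v≉0 {zero} {suc l} _ = flip-≁ 2≉0 l (other₁ l) (other₁≢ l) (v≉0 l) (v≉0 (other₁ l))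
    signChanges-distinct v≉0 {i₁} {i₂} _ =
      ≁-by-signs 2≉0 i₀ i₂ refl (sym (⁻¹-involutive _)) (λ -v₀≈0 → v≉0 i₀ (-x≈0⇒x≈0 -v₀≈0)) (v≉0 i₂)
    signChanges-distinct v≉0 {i₁} {suc i₂} _ =
      ≁-by-signs 2≉0 i₀ i₁ refl (sym (⁻¹-involutive _)) (λ -v₀≈0 → v≉0 i₀ (-x≈0⇒x≈0 -v₀≈0)) (v≉0 i₁)
    signChanges-distinct v≉0 {i₂} {suc i₂} _ =
      ≁-by-signs 2≉0 i₁ i₀ refl (sym (⁻¹-involutive _)) (λ -v₁≈0 → v≉0 i₁ (-x≈0⇒x≈0 -v₁≈0)) (v≉0 i₀)
    signChanges-distinct v≉0 {_} {zero} ()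
    signChanges-distinct v≉0 {i₁} {i₁} (s≤s ())
    signChanges-distinct v≉0 {i₂} {i₁} (s≤s ())
    signChanges-distinct v≉0 {i₂} {i₂} (s≤s (s≤s ()))
    signChanges-distinct v≉0 {suc i₂} {i₁} (s≤s ())
    signChanges-distinct v≉0 {suc i₂} {i₂} (s≤s (s≤s ()))
    signChanges-distinct v≉0 {suc i₂} {suc i₂} (s≤s (s≤s (s≤s ())))

    corner : Vec3 F → Vec3 F → Vec3 F → Fin 3 → Vec3 F
    corner A B C i₀ = A
    corner A B C i₁ = B
    corner A B C i₂ = C

    which : ∀ {w A B C} → w ~ A ⊎ w ~ B ⊎ w ~ C → Fin 3
    which (inj₁ _)        = i₀
    which (inj₂ (inj₁ _)) = i₁
    which (inj₂ (inj₂ _)) = i₂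

    which-sound : ∀ {w A B C} (h : w ~ A ⊎ w ~ B ⊎ w ~ C) → w ~ corner A B C (which h)
    which-sound (inj₁ h)        = h
    which-sound (inj₂ (inj₁ h)) = h
    which-sound (inj₂ (inj₂ h)) = h

    -- A common point off the coordinate lines has four pairwise distinct sign changes, all common points.
    off-coordinate-lines-uncovered : ∀ {A B C} → Covered A B C → ∀ {v} → Common v → (∀ x → ¬ v x ≈ 0#) → ⊥
    off-coordinate-lines-uncovered {A} {B} {C} cover {v} common v≉0 = collision (pigeonhole ℕ.≤-refl slot)
      where
      slot : Fin 4 → Fin 3
      slot m = which (cover _ (signChanges-common common m))
      lies-on : ∀ m → signChanges v m ~ corner A B C (slot m)
      lies-on m = which-sound (cover _ (signChanges-common common m))
      collision : (∃ λ m → ∃ λ n → m Fin.< n × slot m ≡ slot n) → ⊥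
      collision (m , n , m<n , same) = signChanges-distinct v≉0 m<n
        (~-trans (lies-on m) (~-sym (proj₁ (signChanges-common common n))
          (≡.subst (λ c → signChanges v n ~ corner A B C c) (≡.sym same) (lies-on n))))

    ≁-sym : ∀ {u v} → Common v → ¬ u ~ v → ¬ v ~ u
    ≁-sym common u≁v v~u = u≁v (~-sym (proj₁ common) v~u)

    -- A has its zero at k and its partner flipᵢ A is B; then C can neither lie on the line xₖ = 0
    -- (which carries only A and B) nor off it (its partner flipₖ C would be a fourth point).
    third-point-uncovered : ∀ {A B C} → Covered A B C → Common A → Common C → ¬ C ~ A → ¬ C ~ B →
                            ∀ k → A k ≈ 0# → ¬ A (other₂ k) ≈ 0# → flip (other₁ k) A ~ B → ⊥
    third-point-uncovered {A} {B} {C} cover cA cC C≁A C≁B k Aₖ≈0 Aⱼ≉0 A′~B =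
      [ on-line , off-line ]′ (toSum (C k ≟ 0#))
      where
      on-line : C k ≈ 0# → ⊥
      on-line Cₖ≈0 = [ C≁A , (λ C~A′ → C≁B (~-trans C~A′ A′~B)) ]′ (line-meets-twice k cC cA Cₖ≈0 Aₖ≈0 Aⱼ≉0)
      Bₖ≈0 : B k ≈ 0#
      Bₖ≈0 = ~-vanishing k (~-sym (proj₁ (common-flip (other₁ k) cA)) A′~B)
                           (trans (flip-other (other₁ k) k A (other₁≢ k)) Aₖ≈0)
      off-line : ¬ C k ≈ 0# → ⊥
      off-line Cₖ≉0 = [ ≁-by-zero k C′ₖ≉0 Aₖ≈0 , [ ≁-by-zero k C′ₖ≉0 Bₖ≈0 , C′≁C ]′ ]′
                        (cover (flip k C) (common-flip k cC))
        where
        C′ₖ≉0 : ¬ flip k C k ≈ 0#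
        C′ₖ≉0 C′ₖ≈0 = Cₖ≉0 (flip-vanishing k k C C′ₖ≈0)
        C′≁C : ¬ flip k C ~ C
        C′≁C with another-nonzero cC k
        ... | e , e≢k , Cₑ≉0 = ≁-sym (common-flip k cC) (flip-≁ 2≉0 k e e≢k Cₖ≉0 Cₑ≉0)

    diagonal-not-three : ¬ MeetInExactlyThreePoints F (diagForm κ₁) (diagForm κ₂)
    diagonal-not-three (A , B , C , cA , cB , cC , A≁B , A≁C , B≁C , cover) =
      [ off-coordinate-lines-uncovered cover cA , on-coordinate-line ]′ (zeroPattern cA)
      where
      cover′ : Covered A C B
      cover′ v common = Sum.map₂ Sum.swap (cover v common)
      on-coordinate-line : Σ (Fin 3) (λ k → A k ≈ 0# × ¬ A (other₁ k) ≈ 0# × ¬ A (other₂ k) ≈ 0#) → ⊥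
      on-coordinate-line (k , Aₖ≈0 , Aᵢ≉0 , Aⱼ≉0) =
        [ ≁-sym cA′ (flip-≁ 2≉0 (other₁ k) (other₂ k) (λ j≡i → other₁≢other₂ k (≡.sym j≡i)) Aᵢ≉0 Aⱼ≉0)
        , [ third-point-uncovered cover cA cC (≁-sym cC A≁C) (≁-sym cC B≁C) k Aₖ≈0 Aⱼ≉0
          , third-point-uncovered cover′ cA cB (≁-sym cB A≁B) B≁C k Aₖ≈0 Aⱼ≉0 ]′ ]′
          (cover (flip (other₁ k) A) cA′)
        where
        cA′ : Common (flip (other₁ k) A)
        cA′ = common-flip (other₁ k) cA

mainTheorem11 : (q : ℕ) → (∃ λ p → ∃ λ k → Prime p × q ≡ p ^ k) → q % 2 ≡ 1 →
    (F : FiniteField q) → (E₁ E₂ : QForm F) →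
    Proper F E₁ → Proper F E₂ →
    MeetInExactlyThreePoints F E₁ E₂ →
    ¬ SimultaneouslyDiagonalizable F E₁ E₂
mainTheorem11 q _ _ F E₁ E₂ proper₁ _ three (S , (T , ST≈1 , TS≈1) , diag₁ , diag₂) =
  DiagonalConics.diagonal-not-three F κ₁ κ₂ κ₁≉0 (proper⇒two≉0 F {E₁} proper₁) three′
  where
  κ₁ = diagCoeff F E₁ S
  κ₂ = diagCoeff F E₂ S
  κ₁≉0 = diagCoeff-nonzero F {E₁} {S} {T} proper₁ ST≈1 TS≈1 diag₁
  three′ : MeetInExactlyThreePoints F (diagForm F κ₁) (diagForm F κ₂)
  three′ = meetInThree-pullback F {E₁} {E₂} {diagForm F κ₁} {diagForm F κ₂} {S} {T}
    (·v-inverse F {S} {T} ST≈1) (·v-inverse F {T} {S} TS≈1)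
    (diagonalize F {E₁} {S} diag₁) (diagonalize F {E₂} {S} diag₂) three
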